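{- Let $T^*$ be the tree consisting of three paths of length $3$ sharing one common endpoint; that is, $T^*$ has vertices $x$ and $u_j,v_j,w_j$ for $j\in\{1,2,3\}$, with edges $u_jv_j$, $v_jw_j$, $w_jx$ for $j=1,2,3$. Then for every positive integer $t$ the mouse can survive to time $t$ on $T^*$; that is, for every sequence $c_1,\ldots,c_t$ of vertices of $T^*$ there exists a sequence $m_1,\ldots,m_t$ of vertices of $T^*$ with $m_i\neq c_i$ for all $1\le i\le t$ and $m_im_{i+1}$ an edge of $T^*$ for all $1\le i\le t-1$.
   Context: This concerns a cat-and-mouse evasion game on a connected graph $G$. A cat sequence is any sequence $c_1,\ldots,c_t$ of vertices of $G$; a mouse sequence is a sequence $m_1,\ldots,m_t$ of vertices with $m_im_{i+1}\in E(G)$ for $1\le i\le t-1$, and it beats the cat sequence if $m_i\ne c_i$ for all $i$. The mouse can survive to time $t$ on $G$ if every cat sequence of length $t$ is beaten by some mouse sequence. -}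

module Defs where

open import Data.Nat using (ℕ; zero; suc)
open import Data.Unit using (⊤)
open import Data.Fin using (Fin; inject₁) renaming (suc to fsuc)
open import Data.Product using (Σ; _×_)
open import Relation.Binary.PropositionalEquality using (_≡_)
open import Relation.Nullary using (¬_)

data V : Set where
  x : V
  u v w : Fin 3 → V

data Edge₀ : V → V → Set where
  uv : (j : Fin 3) → Edge₀ (u j) (v j)
  vw : (j : Fin 3) → Edge₀ (v j) (w j)
  wx : (j : Fin 3) → Edge₀ (w j) x

data Adj : V → V → Set where
  fwd : ∀ {a b} → Edge₀ a b → Adj a b
  bwd : ∀ {a b} → Edge₀ a b → Adj b a

-- A cat sequence of length t: c_1..c_t, indexed by Fin t (index i ↦ c_{i+1}).
CatSeq : ℕ → Set
CatSeq t = Fin t → V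

-- A mouse sequence of length t: consecutive vertices adjacent.
-- Consecutive pairs of positions in Fin (suc n) are (inject₁ i, suc i) for i : Fin n.
IsWalk : ∀ t → (Fin t → V) → Set
IsWalk zero m = ⊤
IsWalk (suc n) m = (i : Fin n) → Adj (m (inject₁ i)) (m (fsuc i))

Beats : ∀ t → (Fin t → V) → CatSeq t → Set
Beats t m c = IsWalk t m × ((i : Fin t) → ¬ (m i ≡ c i))

MouseSurvives : ℕ → Set
MouseSurvives t = (c : CatSeq t) → Σ (Fin t → V) (λ m → Beats t m c)

module Submission where

-- The mouse knows the whole cat sequence in advance, so we argue backwards in
-- time.  A vertex is safe for the cat sequence c₁ … c_t if the mouse can start
-- there and beat the sequence; a vertex p is safe for c₁ c₂ … c_t exactly when
-- p ≠ c₁ and p has a neighbour that is safe for c₂ … c_t.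
--
-- The heart of the proof is a finite family of "configurations" of T*:
--   the centre {x},  {w_i, w_j},  {v_i, v_j}  and  {u_i, w_j}   (i ≠ j).
-- If every vertex of some configuration K has a property P, then for every cat
-- position c there is a configuration K' each of whose vertices avoids c and
-- has a neighbour with P (lemma advance).  Starting from the trivial property
-- after the last time step and iterating back to the first, some configuration
-- consists of vertices that are safe at time 1 (lemma safe-config).  Configurations
-- are non-empty, so a safe starting vertex exists, and unfolding the definition
-- of safety (lemma safe⇒escape) produces the mouse sequence.

open import Defs
open import Data.Nat using (ℕ; suc; zero)
open import Data.Fin using (Fin; _≟_) renaming (zero to fz; suc to fsuc)
open import Data.Vec.Functional using (_∷_; tail)
open import Data.Unit using (⊤; tt)
open import Data.Product using (Σ; _×_; _,_; proj₁)
open import Data.Sum using (_⊎_; inj₁; inj₂)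
open import Relation.Binary.PropositionalEquality using (_≡_; refl; sym)
open import Relation.Nullary using (¬_; yes; no)

Pre : V → (V → Set) → V → Set
Pre c P p = ¬ p ≡ c × Σ V (λ q → Adj p q × P q)

Safe : (t : ℕ) → CatSeq (suc t) → V → Set
Safe zero    c p = ¬ p ≡ c fz
Safe (suc t) c p = Pre (c fz) (Safe t (tail c)) p

safe⇒escape : ∀ t (c : CatSeq (suc t)) p → Safe t c p →
              Σ (Fin (suc t) → V) (λ m → Beats (suc t) m c × m fz ≡ p)
safe⇒escape zero c p p≢c = (λ _ → p) , ((λ ()) , λ { fz → p≢c }) , refl
safe⇒escape (suc t) c p (p≢c , q , p~q , q-safe)
  with safe⇒escape t (tail c) q q-safe
... | m , (walk , avoid) , m₀≡q = (p ∷ m) , (walk′ , avoid′) , refl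
  where
  walk′ : IsWalk (suc (suc t)) (p ∷ m)
  walk′ fz       rewrite m₀≡q = p~q
  walk′ (fsuc i) = walk i
  avoid′ : (i : Fin (suc (suc t))) → ¬ (p ∷ m) i ≡ c i
  avoid′ fz       = p≢c
  avoid′ (fsuc i) = avoid i

data Config : Set where
  centre : Config
  twoW   : (i j : Fin 3) → ¬ i ≡ j → Config
  twoV   : (i j : Fin 3) → ¬ i ≡ j → Config
  uw     : (i j : Fin 3) → ¬ i ≡ j → Config

Every : (V → Set) → Config → Set
Every P centre         = P x
Every P (twoW i j _)   = P (w i) × P (w j)
Every P (twoV i j _)   = P (v i) × P (v j)
Every P (uw i j _)     = P (u i) × P (w j)

member : ∀ {P} K → Every P K → Σ V P
member centre       Px         = x , Px
member (twoW i _ _) (Pwi , _)  = w i , Pwi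
member (twoV i _ _) (Pvi , _)  = v i , Pvi
member (uw i _ _)   (Pui , _)  = u i , Pui

Every-map : ∀ {P Q : V → Set} → (∀ {p} → P p → Q p) → ∀ K → Every P K → Every Q K
Every-map f centre       Px          = f Px
Every-map f (twoW _ _ _) (Pa , Pb)   = f Pa , f Pb
Every-map f (twoV _ _ _) (Pa , Pb)   = f Pa , f Pb
Every-map f (uw _ _ _)   (Pa , Pb)   = f Pa , f Pb

w-injective : ∀ {i j} → w i ≡ w j → i ≡ j
w-injective refl = refl

at-centre? : (c : V) → c ≡ x ⊎ ¬ x ≡ c
at-centre? x     = inj₁ refl
at-centre? (u _) = inj₂ λ ()
at-centre? (v _) = inj₂ λ ()
at-centre? (w _) = inj₂ λ ()

at-w? : (c : V) (i : Fin 3) → c ≡ w i ⊎ ¬ w i ≡ c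
at-w? x     _ = inj₂ λ ()
at-w? (u _) _ = inj₂ λ ()
at-w? (v _) _ = inj₂ λ ()
at-w? (w k) i with k ≟ i
... | yes refl = inj₁ refl
... | no  k≢i  = inj₂ λ wi≡wk → k≢i (sym (w-injective wi≡wk))

two-free-w : (c : V) → Σ (Fin 3) λ i → Σ (Fin 3) λ j →
             ¬ i ≡ j × ¬ w i ≡ c × ¬ w j ≡ c
two-free-w c with at-w? c fz | at-w? c (fsuc fz)
... | inj₁ refl | _         = fsuc fz , fsuc (fsuc fz) , (λ ()) , (λ ()) , (λ ())
... | inj₂ _    | inj₁ refl = fz , fsuc (fsuc fz) , (λ ()) , (λ ()) , (λ ())
... | inj₂ w₀≢c | inj₂ w₁≢c = fz , fsuc fz , (λ ()) , w₀≢c , w₁≢c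

-- The key step: configurations are closed under going one step back in time.
--   {x}        → two free w's;
--   {w_i,w_j}  → {v_i,v_j} if the cat is at x, else {x};
--   {v_i,v_j}  → {u_i,w_j} if the cat is at w_i (symmetrically for w_j),
--                else {w_i,w_j};
--   {u_i,w_j}  → {v_i,v_j} if the cat is at x, else {x}.
advance : ∀ {P} (c : V) K → Every P K → Σ Config (Every (Pre c P))
advance c centre Px with two-free-w c
... | i , j , i≢j , wi≢c , wj≢c =
  twoW i j i≢j , (wi≢c , x , fwd (wx i) , Px) , (wj≢c , x , fwd (wx j) , Px)
advance c (twoW i j i≢j) (Pwi , Pwj) with at-centre? c
... | inj₁ refl =
  twoV i j i≢j , ((λ ()) , w i , fwd (vw i) , Pwi) , ((λ ()) , w j , fwd (vw j) , Pwj)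
... | inj₂ x≢c  = centre , x≢c , w i , bwd (wx i) , Pwi
advance c (twoV i j i≢j) (Pvi , Pvj) with at-w? c i | at-w? c j
... | inj₁ refl | _ =
  uw i j i≢j , ((λ ()) , v i , fwd (uv i) , Pvi) , ((λ e → i≢j (sym (w-injective e))) , v j , bwd (vw j) , Pvj)
... | inj₂ _ | inj₁ refl =
  uw j i (λ e → i≢j (sym e)) , ((λ ()) , v j , fwd (uv j) , Pvj) , ((λ e → i≢j (w-injective e)) , v i , bwd (vw i) , Pvi)
... | inj₂ wi≢c | inj₂ wj≢c =
  twoW i j i≢j , (wi≢c , v i , bwd (vw i) , Pvi) , (wj≢c , v j , bwd (vw j) , Pvj)
advance c (uw i j i≢j) (Pui , Pwj) with at-centre? c
... | inj₁ refl =
  twoV i j i≢j , ((λ ()) , u i , bwd (uv i) , Pui) , ((λ ()) , w j , fwd (vw j) , Pwj)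
... | inj₂ x≢c  = centre , x≢c , w j , bwd (wx j) , Pwj

-- At the
-- last time step, safety only asks to avoid the cat, so any configuration
-- produced by advance from the trivial property will do.
safe-config : ∀ t (c : CatSeq (suc t)) → Σ Config (Every (Safe t c))
safe-config zero c with advance {λ _ → ⊤} (c fz) centre tt
... | K , pre = K , Every-map proj₁ K pre
safe-config (suc t) c with safe-config t (tail c)
... | K , safe = advance (c fz) K safe

lemma1 : (t : ℕ) → MouseSurvives (suc t)
lemma1 t c with safe-config t c
... | K , safe with member K safe
... | p , p-safe with safe⇒escape t c p p-safe
... | m , beats , _ = m , beats
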